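{- There exist $3$-connected $4$-regular planar graphs that contain no HIST and that are the line graph of a cubic graph.
   Context: A HIST of a graph is a spanning tree in which no vertex has degree $2$. -}

module Defs where

open import Data.Nat using (ℕ; zero; suc; _+_; _*_; _<_; _≤_; _<ᵇ_; _≤ᵇ_)
open import Data.Bool using (Bool; true; false; if_then_else_; _∧_; not)
open import Data.Fin using (Fin; toℕ)
open import Data.Product using (Σ; ∃; _×_; _,_; proj₁; proj₂)
open import Data.Sum using (_⊎_)
open import Data.List using (List; []; _∷_; _++_; [_]; length)
open import Data.List.Relation.Unary.Linked using (Linked)
open import Data.List.Relation.Unary.Unique.Propositional using (Unique)
open import Data.Empty using (⊥)
open import Function using (_∘_; _⇔_)
open import Relation.Nullary using (¬_)
open import Relation.Binary.PropositionalEquality using (_≡_; _≢_)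

record Graph : Set where
  field
    n      : ℕ
    adj    : Fin n → Fin n → Bool
    sym    : ∀ u v → adj u v ≡ adj v u
    irrefl : ∀ v → adj v v ≡ false
open Graph public

count : ∀ {n} → (Fin n → Bool) → ℕ
count {zero}  f = 0
count {suc n} f = (if f Fin.zero then 1 else 0) + count (f ∘ Fin.suc)

sumFin : ∀ {n} → (Fin n → ℕ) → ℕ
sumFin {zero}  f = 0
sumFin {suc n} f = f Fin.zero + sumFin (f ∘ Fin.suc)

degree : (G : Graph) → Fin (n G) → ℕ
degree G v = count (adj G v)

Regular : ℕ → Graph → Set
Regular k G = ∀ v → degree G v ≡ k

Cubic : Graph → Set
Cubic = Regular 3

data Reach {m : ℕ} (A : Fin m → Fin m → Bool) (ok : Fin m → Bool)
     : Fin m → Fin m → Set where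
  here : ∀ {v} → ok v ≡ true → Reach A ok v v
  step : ∀ {u w v} → ok u ≡ true → A u w ≡ true → Reach A ok w v → Reach A ok u v

ConnectedAdj : ∀ {m} → (Fin m → Fin m → Bool) → Set
ConnectedAdj {m} A = ∀ (u v : Fin m) → Reach A (λ _ → true) u v

KConnected : ℕ → Graph → Set
KConnected k G =
  k < n G ×
  (∀ (S : Fin (n G) → Bool) → count S < k →
     ∀ u v → S u ≡ false → S v ≡ false → Reach (adj G) (not ∘ S) u v)

IsCycle : ∀ {m} → (Fin m → Fin m → Bool) → List (Fin m) → Set
IsCycle A []       = ⊥
IsCycle A (v ∷ vs) =
  2 ≤ length vs × Unique (v ∷ vs) ×
  Linked (λ x y → A x y ≡ true) (v ∷ vs ++ [ v ])

Acyclic : ∀ {m} → (Fin m → Fin m → Bool) → Set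
Acyclic {m} A = ∀ (c : List (Fin m)) → ¬ IsCycle A c

record SpanningTree (G : Graph) (T : Fin (n G) → Fin (n G) → Bool) : Set where
  field
    symT      : ∀ u v → T u v ≡ T v u
    subgraph  : ∀ u v → T u v ≡ true → adj G u v ≡ true
    connected : ConnectedAdj T
    acyclic   : Acyclic T

IsHIST : (G : Graph) → (Fin (n G) → Fin (n G) → Bool) → Set
IsHIST G T = SpanningTree G T × (∀ v → count (T v) ≢ 2)

HasHIST : Graph → Set
HasHIST G = Σ (Fin (n G) → Fin (n G) → Bool) (IsHIST G)

-- Line graphs: G ≅ L(H).  e x = (a , b) with a < b is the edge of H
-- corresponding to the vertex x of G; e is a bijection onto E(H), and two
-- distinct vertices of G are adjacent iff their edges share an endpoint.

ShareEnd : ∀ {m} → Fin m × Fin m → Fin m × Fin m → Set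
ShareEnd (a , b) (c , d) = (a ≡ c ⊎ a ≡ d) ⊎ (b ≡ c ⊎ b ≡ d)

record IsLineGraphOf (G H : Graph) : Set where
  field
    e        : Fin (n G) → Fin (n H) × Fin (n H)
    ordered  : ∀ x → toℕ (proj₁ (e x)) < toℕ (proj₂ (e x))
    isEdge   : ∀ x → adj H (proj₁ (e x)) (proj₂ (e x)) ≡ true
    inj      : ∀ x y → e x ≡ e y → x ≡ y
    surj     : ∀ a b → toℕ a < toℕ b → adj H a b ≡ true → ∃ λ x → e x ≡ (a , b)
    adjIff   : ∀ x y → (adj G x y ≡ true) ⇔ (x ≢ y × ShareEnd (e x) (e y))

-- Planarity via combinatorial embeddings (rotation systems) and Euler's
-- formula: a connected graph is planar iff it has a rotation system whose
-- number of faces F satisfies V - E + F = 2.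

iter : ∀ {A : Set} → (A → A) → ℕ → A → A
iter f zero    x = x
iter f (suc k) x = iter f k (f x)

-- σ v : cyclic successor map on the neighbourhood of v (one single cycle)
record IsRotation (G : Graph) (σ : Fin (n G) → Fin (n G) → Fin (n G)) : Set where
  field
    closed : ∀ v u → adj G v u ≡ true → adj G v (σ v u) ≡ true
    cyclic : ∀ v u w → adj G v u ≡ true → adj G v w ≡ true →
             ∃ λ k → iter (σ v) k u ≡ w

-- face-tracing permutation on darts (u , v): arrive at v from u, leave
-- along the successor of u in the rotation at v
faceStep : (G : Graph) → (Fin (n G) → Fin (n G) → Fin (n G)) →
           Fin (n G) × Fin (n G) → Fin (n G) × Fin (n G)
faceStep G σ (u , v) = (v , σ v u)

dartKey : (G : Graph) → Fin (n G) × Fin (n G) → ℕ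
dartKey G (u , v) = toℕ u * n G + toℕ v

minUpTo : (G : Graph) → (Fin (n G) → Fin (n G) → Fin (n G)) →
          Fin (n G) × Fin (n G) → ℕ → Bool
minUpTo G σ d zero    = true
minUpTo G σ d (suc k) =
  (dartKey G d ≤ᵇ dartKey G (iter (faceStep G σ) (suc k) d)) ∧ minUpTo G σ d k

-- number of faces = number of face-orbits of darts (each counted at its
-- key-minimal dart; orbits have length ≤ number of darts ≤ n²)
faces : (G : Graph) → (Fin (n G) → Fin (n G) → Fin (n G)) → ℕ
faces G σ = sumFin (λ u → count (λ v → adj G u v ∧ minUpTo G σ (u , v) (n G * n G)))

edges : Graph → ℕ
edges G = sumFin (λ u → count (λ v → adj G u v ∧ (toℕ u <ᵇ toℕ v)))

-- planarity (for connected graphs with at least one edge)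
Planar : Graph → Set
Planar G = Σ (Fin (n G) → Fin (n G) → Fin (n G)) λ σ →
  IsRotation G σ × (n G + faces G σ ≡ edges G + 2)

{-# OPTIONS --safe #-}
-- G is the line graph of the truncated triangular prism H (every vertex of the prism replaced by a
-- triangle).  It is 4-regular as the line graph of a cubic graph, planar (a rotation system with 29
-- faces satisfies Euler's formula) and 3-connected (breadth-first search after deleting any two
-- vertices).
--
-- No HIST: the 54 edges of G split into the 18 triangles of L(H) at the vertices of H.  A triangle
-- of H gives a gadget of six vertices of G: its three edges and the three edges of H leaving it,
-- the ports.  In a spanning tree without vertices of degree 2, twice the number of tree edges inside
-- a gadget is at most 7 plus the number of its ports joined to it by exactly one tree edge, and no
-- port is joined in this way to both of its gadgets, for it would have degree 2.  Summing over the
-- six gadgets gives 2 · 26 ≤ 6 · 7 + 9, a contradiction.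
module Submission where

open import Defs hiding (sym)
open import Data.Bool using (Bool; true; false; not; _∧_; _∨_; _xor_; if_then_else_)
import Data.Bool as Bool
open import Data.Bool.ListAction using (any)
open import Data.Bool.Properties
  using (∧-zeroʳ; ∧-identityʳ; ∨-zeroʳ; ∨-identityʳ; ∧-comm; ∨-comm; ∧-conicalˡ; ∧-conicalʳ; T-≡; ¬-not)
open import Data.Empty using (⊥; ⊥-elim)
open import Data.Fin using (Fin; zero; suc; toℕ; punchIn; _≟_; #_; _↑ˡ_; _↑ʳ_; combine; remQuot)
open import Data.Fin.Patterns using (0F; 1F; 2F)
open import Data.Fin.Permutation using (permutation)
open import Data.Fin.Properties using (punchInᵢ≢i; any?; all?; remQuot-combine; combine-remQuot)
open import Data.List using (List; []; _∷_; map)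
open import Data.List.Membership.Propositional using (_∈_; find)
open import Data.List.Membership.DecPropositional {A = Fin 27} _≟_ using (_∈?_)
open import Data.List.Properties using (map-cong-local)
open import Data.List.Relation.Unary.All using (All; []; _∷_)
import Data.List.Relation.Unary.All as All
open import Data.List.Relation.Unary.AllPairs using ([]; _∷_)
open import Data.List.Relation.Unary.Any using (here; there)
open import Data.List.Relation.Unary.Any.Properties using (any⁻)
open import Data.List.Relation.Unary.Linked using ([-]; _∷_)
open import Data.List.Relation.Unary.Unique.Propositional using (Unique)
open import Data.List.Relation.Unary.Unique.DecPropositional {A = Fin 27} _≟_ using (unique?)
open import Data.Nat using (ℕ; zero; suc; _+_; _*_; _∸_; _≤_; _<_; _≤?_; _<?_; _≤ᵇ_; z≤n; s≤s)
import Data.Nat as ℕ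
open import Data.Nat.ListAction using (sum)
open import Data.Nat.Properties
  using ( ≤-refl; ≤-trans; ≤-pred; n≤1+n; m≤m+n; <-irrefl; <-asym; <⇒≱; ≤⇒≯; ≤⇒≤ᵇ; m≤n⇒m<n∨m≡n
        ; +-comm; +-assoc; +-identityʳ; +-mono-≤; +-mono-<-≤; +-cancelˡ-≤; *-monoʳ-≤; m∸n+n≡m
        ; +-*-semiring; module ≤-Reasoning)
open import Algebra.Properties.Semiring.Sum +-*-semiring
  using (sum-syntax; sum-remove; sum-cong-≗; ∑-permute; ∑-distrib-+; *-distribˡ-sum)
  renaming (sum to ∑)
open import Data.Product using (Σ; ∃; ∃₂; _×_; _,_; proj₁; proj₂; uncurry)
import Data.Product as Product
open import Data.Product.Properties using (≡-dec)
open import Data.Sum using (_⊎_; inj₁; inj₂)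
open import Data.Vec using (Vec; []; _∷_; lookup; tabulate; toList)
open import Data.Vec.Properties using (lookup∘tabulate)
open import Function using (_∘_; id)
open import Function.Bundles using (Equivalence; mk⇔)
open import Relation.Binary.PropositionalEquality
open import Relation.Nullary using (¬_; ¬?; Dec; yes; no; does; contradiction)
open import Relation.Nullary.Decidable
  using (dec-true; dec-false; does-⇔; map′; from-yes; _×-dec_; _⊎-dec_; _→-dec_)

-- Counting and finite sums

ind : Bool → ℕ
ind b = if b then 1 else 0

count≡∑ : ∀ {n} (f : Fin n → Bool) → count f ≡ ∑[ i < n ] ind (f i)
count≡∑ {zero}  f = refl
count≡∑ {suc n} f = cong (ind (f zero) +_) (count≡∑ (f ∘ suc))

count-cong : ∀ {n} {f g : Fin n → Bool} → (∀ i → f i ≡ g i) → count f ≡ count g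
count-cong {f = f} {g} f≗g = trans (count≡∑ f) (trans (sum-cong-≗ (cong ind ∘ f≗g)) (sym (count≡∑ g)))

_─_ : ∀ {n} → (Fin n → Bool) → Fin n → Fin n → Bool
(f ─ w) x = f x ∧ not (does (x ≟ w))

count-remove : ∀ {n} (f : Fin n → Bool) (w : Fin n) → count f ≡ ind (f w) + count (f ─ w)
count-remove {suc n} f w =
  trans (trans (count≡∑ f) (sum-remove {i = w} (ind ∘ f))) (cong (ind (f w) +_) (sym rest))
  where
  removed : (f ─ w) w ≡ false
  removed rewrite dec-true (w ≟ w) refl = ∧-zeroʳ (f w)
  untouched : ∀ j → (f ─ w) (punchIn w j) ≡ f (punchIn w j)
  untouched j rewrite dec-false (punchIn w j ≟ w) (punchInᵢ≢i w j) = ∧-identityʳ _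
  rest : count (f ─ w) ≡ ∑[ j < n ] ind (f (punchIn w j))
  rest = trans (trans (count≡∑ (f ─ w)) (sum-remove {i = w} (ind ∘ (f ─ w))))
               (cong₂ _+_ (cong ind removed) (sum-cong-≗ (cong ind ∘ untouched)))

count-none : ∀ {n} (f : Fin n → Bool) → (∀ x → f x ≡ false) → count f ≡ 0
count-none {zero}  f none = refl
count-none {suc n} f none rewrite none zero = count-none (f ∘ suc) (none ∘ suc)

count-enumerated : ∀ {n} (f : Fin n → Bool) (ws : List (Fin n)) → Unique ws →
                   (∀ x → f x ≡ true → x ∈ ws) → count f ≡ sum (map (ind ∘ f) ws)
count-enumerated f []       _               covers = count-none f none
  where
  none : ∀ x → f x ≡ false
  none x with f x in fx
  ... | true  with () ← covers x fx
  ... | false = refl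
count-enumerated f (w ∷ ws) (w∉ws ∷ uniq) covers = begin
  count f                                   ≡⟨ count-remove f w ⟩
  ind (f w) + count (f ─ w)                 ≡⟨ cong (ind (f w) +_) (count-enumerated (f ─ w) ws uniq covers′) ⟩
  ind (f w) + sum (map (ind ∘ (f ─ w)) ws)  ≡⟨ cong (λ xs → ind (f w) + sum xs) (map-cong-local (All.map kept w∉ws)) ⟩
  ind (f w) + sum (map (ind ∘ f) ws)        ∎
  where
  open ≡-Reasoning
  kept : ∀ {x} → w ≢ x → ind ((f ─ w) x) ≡ ind (f x)
  kept {x} w≢x rewrite dec-false (x ≟ w) (w≢x ∘ sym) = cong ind (∧-identityʳ (f x))
  covers′ : ∀ x → (f ─ w) x ≡ true → x ∈ ws
  covers′ x fx with x ≟ w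
  ... | yes _ rewrite ∧-zeroʳ (f x) with () ← fx
  ... | no x≢w with covers x (trans (sym (∧-identityʳ (f x))) fx)
  ...   | here x≡w   = ⊥-elim (x≢w x≡w)
  ...   | there x∈ws = x∈ws

count-pos : ∀ {n} (f : Fin n → Bool) {w} → f w ≡ true → 1 ≤ count f
count-pos f {w} fw rewrite count-remove f w | fw = s≤s z≤n

count<n⇒∃false : ∀ {n} (f : Fin n → Bool) → count f < n → ∃ λ w → f w ≡ false
count<n⇒∃false {suc n} f lt with f zero in f0
... | false = zero , f0
... | true  = let w , fw = count<n⇒∃false (f ∘ suc) (≤-pred lt) in suc w , fw

0<count⇒∃true : ∀ {n} (f : Fin n → Bool) → 0 < count f → ∃ λ w → f w ≡ true
0<count⇒∃true {suc n} f pos with f zero in f0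
... | true  = zero , f0
... | false = let w , fw = 0<count⇒∃true (f ∘ suc) pos in suc w , fw

insert : ∀ {n} → (Fin n → Bool) → Fin n → Fin n → Bool
insert S y x = S x ∨ does (x ≟ y)

insert-new : ∀ {n} (S : Fin n → Bool) y → insert S y y ≡ true
insert-new S y rewrite dec-true (y ≟ y) refl = ∨-zeroʳ (S y)

insert-old : ∀ {n} (S : Fin n → Bool) y {x} → S x ≡ true → insert S y x ≡ true
insert-old S y Sx rewrite Sx = refl

count-insert : ∀ {n} (S : Fin n → Bool) {y} → S y ≡ false → count (insert S y) ≡ suc (count S)
count-insert S {y} Sy = begin
  count (insert S y)                   ≡⟨ count-remove (insert S y) y ⟩
  ind (insert S y y) + count (insert S y ─ y) ≡⟨ cong₂ _+_ (cong ind (insert-new S y)) (count-cong same) ⟩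
  1 + count (S ─ y)                    ≡⟨ cong (λ b → suc (ind b + count (S ─ y))) Sy ⟨
  suc (ind (S y) + count (S ─ y))      ≡⟨ cong suc (count-remove S y) ⟨
  suc (count S)                        ∎
  where
  open ≡-Reasoning
  same : ∀ x → (insert S y ─ y) x ≡ (S ─ y) x
  same x with x ≟ y
  ... | yes _ = trans (∧-zeroʳ _) (sym (∧-zeroʳ _))
  ... | no  _ = cong (_∧ true) (∨-identityʳ (S x))

∑-mono-≤ : ∀ {n} {f g : Fin n → ℕ} → (∀ i → f i ≤ g i) → ∑[ i < n ] f i ≤ ∑[ i < n ] g i
∑-mono-≤ {zero}  f≤g = z≤n
∑-mono-≤ {suc n} f≤g = +-mono-≤ (f≤g zero) (∑-mono-≤ (f≤g ∘ suc))

∑-mono-< : ∀ {n} {f g : Fin n → ℕ} → (∀ i → f i ≤ g i) → ∀ j → f j < g j → ∑[ i < n ] f i < ∑[ i < n ] g i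
∑-mono-< {suc n} {f} {g} f≤g j fj<gj = begin-strict
  ∑[ i < suc n ] f i                       ≡⟨ sum-remove {i = j} f ⟩
  f j + ∑[ i < n ] f (punchIn j i)         <⟨ +-mono-<-≤ fj<gj (∑-mono-≤ (f≤g ∘ punchIn j)) ⟩
  g j + ∑[ i < n ] g (punchIn j i)         ≡⟨ sum-remove {i = j} g ⟨
  ∑[ i < suc n ] g i                       ∎
  where open ≤-Reasoning

ind-mono : ∀ {a b} → (a ≡ true → b ≡ true) → ind a ≤ ind b
ind-mono {false}         _   = z≤n
ind-mono {true}  {true}  _   = ≤-refl
ind-mono {true}  {false} a⇒b with () ← a⇒b refl

∑-↑ : ∀ {a b} (g : Fin (a + b) → ℕ) → ∑[ j < a + b ] g j ≡ ∑[ i < a ] g (i ↑ˡ b) + ∑[ i < b ] g (a ↑ʳ i)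
∑-↑ {zero}  g = refl
∑-↑ {suc a} {b} g = trans (cong (g zero +_) (∑-↑ {a} {b} (g ∘ suc))) (sym (+-assoc (g zero) _ _))

∑-combine : ∀ {m n} (g : Fin (m * n) → ℕ) → ∑[ j < m * n ] g j ≡ ∑[ i < m ] ∑[ r < n ] g (combine i r)
∑-combine {zero}  g = refl
∑-combine {suc m} {n} g =
  trans (∑-↑ {n} {m * n} g) (cong (∑[ r < n ] g (combine {suc m} zero r) +_) (∑-combine {m} {n} (g ∘ (n ↑ʳ_))))

∑-remQuot : ∀ {m n} (f : Fin m × Fin n → ℕ) → ∑[ j < m * n ] f (remQuot n j) ≡ ∑[ i < m ] ∑[ r < n ] f (i , r)
∑-remQuot {m} {n} f = trans (∑-combine {m} {n} (f ∘ remQuot {m} n))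
  (sum-cong-≗ λ i → sum-cong-≗ λ r → cong f (remQuot-combine i r))

∑-involution : ∀ {n} (π : Fin n → Fin n) → (∀ i → π (π i) ≡ i) → ∀ f → ∑[ i < n ] f (π i) ≡ ∑[ i < n ] f i
∑-involution π π²≡id f = sym (∑-permute f (permutation π π π²≡id π²≡id))

∑-Fin3 : ∀ (g : Fin 3 → ℕ) → ∑[ k < 3 ] g k ≡ g 0F + g 1F + g 2F
∑-Fin3 g = trans (sym (+-assoc (g 0F) (g 1F) _)) (cong (g 0F + g 1F +_) (+-identityʳ (g 2F)))

-- Walks, spanning subgraphs and connectivity

module _ {m : ℕ} {A : Fin m → Fin m → Bool} where

  Reach-snoc : ∀ {ok u x w} → Reach A ok u x → A x w ≡ true → ok w ≡ true → Reach A ok u w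
  Reach-snoc (here okx)         Axw okw = step okx Axw (here okw)
  Reach-snoc (step oku Auy u⇝x) Axw okw = step oku Auy (Reach-snoc u⇝x Axw okw)

  Reach-trans : ∀ {ok u x w} → Reach A ok u x → Reach A ok x w → Reach A ok u w
  Reach-trans (here _)           x⇝w = x⇝w
  Reach-trans (step oku Auy y⇝x) x⇝w = step oku Auy (Reach-trans y⇝x x⇝w)

  Reach-sym : (∀ u v → A u v ≡ A v u) → ∀ {ok u w} → Reach A ok u w → Reach A ok w u
  Reach-sym A-sym (here ok) = here ok
  Reach-sym A-sym (step {u} {y} oku Auy y⇝w) = Reach-snoc (Reach-sym A-sym y⇝w) (trans (A-sym y u) Auy) oku

  Reach-mono : ∀ {ok ok′ u w} → (∀ x → ok x ≡ true → ok′ x ≡ true) → Reach A ok u w → Reach A ok′ u w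
  Reach-mono ok⊆ok′ (here ok)          = here (ok⊆ok′ _ ok)
  Reach-mono ok⊆ok′ (step ok Auy y⇝w) = step (ok⊆ok′ _ ok) Auy (Reach-mono ok⊆ok′ y⇝w)

  Reach-leaves : ∀ (S : Fin m → Bool) {ok u w} → Reach A ok u w → S u ≡ true → S w ≡ false →
                 ∃₂ λ x y → S x ≡ true × S y ≡ false × A x y ≡ true
  Reach-leaves S (here _) Su Sw with () ← trans (sym Su) Sw
  Reach-leaves S (step {u} {y} _ Auy y⇝w) Su Sw with S y in Sy
  ... | true  = Reach-leaves S y⇝w Sy Sw
  ... | false = u , y , Su , Sy , Auy

module SpanningEdges {n m : ℕ} (T : Fin n → Fin n → Bool) (T-sym : ∀ u v → T u v ≡ T v u)
  (E : Fin m → Fin n × Fin n) (E-covers : ∀ u v → T u v ≡ true → ∃ λ j → E j ≡ (u , v) ⊎ E j ≡ (v , u))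
  where

  within : (Fin n → Bool) → Fin n × Fin n → Bool
  within S (u , v) = T u v ∧ S u ∧ S v

  ∅ : Fin n → Bool
  ∅ _ = false

  ∅-count : count ∅ ≡ 0
  ∅-count = count-none ∅ λ _ → refl

  inside : (Fin n → Bool) → ℕ
  inside S = ∑[ j < m ] ind (within S (E j))

  within-mono : ∀ {S S′} → (∀ x → S x ≡ true → S′ x ≡ true) → ∀ e → within S e ≡ true → within S′ e ≡ true
  within-mono {S} sub (u , v) _ with T u v | S u in Su | S v in Sv
  ... | true | true | true rewrite sub u Su | sub v Sv = refl

  within-edge : ∀ S {x y e} → e ≡ (x , y) ⊎ e ≡ (y , x) → within S e ≡ (T x y ∧ S x ∧ S y)
  within-edge S (inj₁ refl)         = refl
  within-edge S {x} {y} (inj₂ refl) = cong₂ _∧_ (T-sym y x) (∧-comm (S y) (S x))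

  inside-grows : ∀ {S S′} → (∀ x → S x ≡ true → S′ x ≡ true) →
                 ∀ {x y} → T x y ≡ true → S′ x ≡ true → S′ y ≡ true → S y ≡ false → inside S < inside S′
  inside-grows {S} {S′} sub {x} {y} Txy S′x S′y Sy with E-covers x y Txy
  ... | j , Ej = ∑-mono-< (λ i → ind-mono (within-mono sub (E i))) j
                   (subst₂ (λ a b → ind a < ind b) (sym (within-edge S Ej)) (sym (within-edge S′ Ej)) new-edge)
    where
    new-edge : ind (T x y ∧ S x ∧ S y) < ind (T x y ∧ S′ x ∧ S′ y)
    new-edge rewrite Txy | S′x | S′y | Sy | ∧-zeroʳ (S x) = s≤s z≤n

  growing-subsets : ConnectedAdj T → ∀ k → suc k ≤ n → ∃ λ S → count S ≡ suc k × k ≤ inside S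
  growing-subsets conn zero 1≤n with count<n⇒∃false ∅ (subst (_< n) (sym ∅-count) 1≤n)
  ... | v , _ = insert ∅ v , trans (count-insert ∅ refl) (cong suc ∅-count) , z≤n
  growing-subsets conn (suc k) 2+k≤n with growing-subsets conn k (≤-trans (n≤1+n _) 2+k≤n)
  ... | S , |S| , k≤
    with count<n⇒∃false S (subst (_< n) (sym |S|) 2+k≤n) | 0<count⇒∃true S (subst (0 <_) (sym |S|) (s≤s z≤n))
  ...   | w , Sw | u , Su with Reach-leaves S (conn u w) Su Sw
  ...     | x , y , Sx , Sy , Txy =
    insert S y , trans (count-insert S Sy) (cong suc |S|) ,
    ≤-trans (s≤s k≤) (inside-grows (λ _ → insert-old S y) Txy (insert-old S y Sx) (insert-new S y) Sy)

connected⇒spanning-edges : ∀ {n m} (T : Fin n → Fin n → Bool) → (∀ u v → T u v ≡ T v u) →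
  (E : Fin m → Fin n × Fin n) → (∀ u v → T u v ≡ true → ∃ λ j → E j ≡ (u , v) ⊎ E j ≡ (v , u)) →
  ConnectedAdj T → n ≤ suc (∑[ j < m ] ind (T (proj₁ (E j)) (proj₂ (E j))))
connected⇒spanning-edges {zero}  T T-sym E E-covers conn = z≤n
connected⇒spanning-edges {suc k} T T-sym E E-covers conn with growing-subsets conn k ≤-refl
  where open SpanningEdges T T-sym E E-covers
... | S , _ , k≤ = s≤s (≤-trans k≤ (∑-mono-≤ λ j → ind-mono (∧-conicalˡ (T (proj₁ (E j)) (proj₂ (E j))) _)))

adjacent⇒distinct : ∀ {m} {A : Fin m → Fin m → Bool} → (∀ v → A v v ≡ false) → ∀ {x y} → A x y ≡ true → x ≢ y
adjacent⇒distinct irr {x} Axy refl with () ← trans (sym (irr x)) Axy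

acyclic⇒no-triangle : ∀ {m} {A : Fin m → Fin m → Bool} → Acyclic A → (∀ v → A v v ≡ false) →
                      ∀ {x y z} → A x y ≡ true → A y z ≡ true → A z x ≡ true → ⊥
acyclic⇒no-triangle {A = A} acyclic irr Axy Ayz Azx =
  acyclic (_ ∷ _ ∷ _ ∷ [])
    ( s≤s (s≤s z≤n)
    , (distinct Axy ∷ (distinct Azx ∘ sym) ∷ []) ∷ (distinct Ayz ∷ []) ∷ [] ∷ []
    , Axy ∷ Ayz ∷ Azx ∷ [-])
  where
  distinct : ∀ {x y} → A x y ≡ true → x ≢ y
  distinct = adjacent⇒distinct irr

module BreadthFirst {n : ℕ} (A : Fin n → Fin n → Bool) (A-sym : ∀ u v → A u v ≡ A v u)
  (nbrs : Fin n → List (Fin n)) (nbrs⊆A : ∀ v → All (λ w → A v w ≡ true) (nbrs v))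
  (ok : Fin n → Bool) (r : Fin n)
  where

  expand : Vec Bool n → Vec Bool n
  expand R = tabulate λ w → lookup R w ∨ (ok w ∧ any (lookup R) (nbrs w))

  reached : ℕ → Vec Bool n
  reached zero    = tabulate λ w → does (w ≟ r)
  reached (suc k) = expand (reached k)

  covers? : (R : Vec Bool n) → Dec (∀ w → ok w ≡ true → lookup R w ≡ true)
  covers? R = all? λ w → ok w Bool.≟ true →-dec lookup R w Bool.≟ true

  module _ (ok-r : ok r ≡ true) where

    reached-sound : ∀ k w → lookup (reached k) w ≡ true → Reach A ok r w
    reached-sound zero w w≟r rewrite lookup∘tabulate (λ w → does (w ≟ r)) w with w ≟ r
    ... | yes refl = here ok-r
    reached-sound (suc k) w R′w
      rewrite lookup∘tabulate (λ w → lookup (reached k) w ∨ (ok w ∧ any (lookup (reached k)) (nbrs w))) w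
      with lookup (reached k) w in Rw
    ... | true  = reached-sound k w Rw
    ... | false with find (any⁻ (lookup (reached k)) (nbrs w) (Equivalence.from T-≡ (∧-conicalʳ (ok w) _ R′w)))
    ...   | x , x∈nbrs , Rx = Reach-snoc (reached-sound k x (Equivalence.to T-≡ Rx))
                                (trans (A-sym x w) (All.lookup (nbrs⊆A w) x∈nbrs)) (∧-conicalˡ (ok w) _ R′w)

    covers-sound : ∀ k → (∀ w → ok w ≡ true → lookup (reached k) w ≡ true) →
                   ∀ u v → ok u ≡ true → ok v ≡ true → Reach A ok u v
    covers-sound k covered u v ok-u ok-v =
      Reach-trans (Reach-sym A-sym (reached-sound k u (covered u ok-u))) (reached-sound k v (covered v ok-v))

avoiding : ∀ {n} → Fin n → Fin n → Fin n → Bool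
avoiding s t x = not (does (x ≟ s) ∨ does (x ≟ t))

at-most-two : ∀ {n} (S : Fin n → Bool) → count S < 3 →
  (∀ x → S x ≡ false) ⊎ ∃₂ λ s t → S s ≡ true × S t ≡ true × (∀ x → S x ≡ true → x ≡ s ⊎ x ≡ t)
at-most-two S |S|<3 with any? (λ x → S x Bool.≟ true)
... | no  ∄ = inj₁ λ x → ¬-not (λ Sx → ∄ (x , Sx))
... | yes (s , Ss) with any? (λ x → (S ─ s) x Bool.≟ true)
...   | no ∄ = inj₂ (s , s , Ss , Ss , λ x Sx → inj₁ (only-s x Sx))
  where
  only-s : ∀ x → S x ≡ true → x ≡ s
  only-s x Sx with x ≟ s in x≟s
  ... | yes x≡s = x≡s
  ... | no  _   = ⊥-elim (∄ (x , trans (cong (λ d → S x ∧ not (does d)) x≟s) (trans (∧-identityʳ _) Sx)))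
...   | yes (t , t∈S─s) = inj₂ (s , t , Ss , ∧-conicalˡ (S t) _ t∈S─s , cover)
  where
  cover : ∀ x → S x ≡ true → x ≡ s ⊎ x ≡ t
  cover x Sx with x ≟ s | x ≟ t
  ... | yes x≡s | _       = inj₁ x≡s
  ... | no  _   | yes x≡t = inj₂ x≡t
  ... | no  x≢s | no  x≢t = ⊥-elim (<⇒≱ |S|<3 (begin
      3                                      ≤⟨ s≤s (s≤s (count-pos rest x∈rest)) ⟩
      1 + (1 + count rest)                   ≡⟨ cong₂ (λ a b → ind a + (ind b + count rest)) Ss t∈S─s ⟨
      ind (S s) + (ind ((S ─ s) t) + count rest) ≡⟨ cong (ind (S s) +_) (count-remove (S ─ s) t) ⟨
      ind (S s) + count (S ─ s)              ≡⟨ count-remove S s ⟨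
      count S                                ∎))
    where
    open ≤-Reasoning
    rest : Fin _ → Bool
    rest = (S ─ s) ─ t
    x∈rest : rest x ≡ true
    x∈rest rewrite dec-false (x ≟ s) x≢s | dec-false (x ≟ t) x≢t | Sx = refl

three-connected : (G : Graph) → 3 < n G → ConnectedAdj (adj G) →
  (∀ s t u v → avoiding s t u ≡ true → avoiding s t v ≡ true → Reach (adj G) (avoiding s t) u v) →
  KConnected 3 G
three-connected G 3<n conn conn-avoiding = 3<n , survives
  where
  survives : ∀ S → count S < 3 → ∀ u v → S u ≡ false → S v ≡ false → Reach (adj G) (not ∘ S) u v
  survives S |S|<3 u v Su Sv with at-most-two S |S|<3
  ... | inj₁ none = Reach-mono (λ x _ → cong not (none x)) (conn u v)
  ... | inj₂ (s , t , Ss , St , cover) =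
    Reach-mono kept (conn-avoiding s t u v (outside Su) (outside Sv))
    where
    outside : ∀ {x} → S x ≡ false → avoiding s t x ≡ true
    outside {x} Sx rewrite dec-false (x ≟ s) (λ { refl → contradiction (trans (sym Sx) Ss) λ () })
                         | dec-false (x ≟ t) (λ { refl → contradiction (trans (sym Sx) St) λ () }) = refl
    kept : ∀ x → avoiding s t x ≡ true → not (S x) ≡ true
    kept x avoids with S x in Sx
    ... | false = refl
    ... | true with cover x Sx
    ...   | inj₁ refl rewrite dec-true (x ≟ x) refl with () ← avoids
    ...   | inj₂ refl rewrite dec-true (x ≟ x) refl | ∨-zeroʳ (does (x ≟ s)) with () ← avoids

-- Faces of a rotation system

iter-+ : ∀ {A : Set} (f : A → A) a b x → iter f (a + b) x ≡ iter f b (iter f a x)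
iter-+ f zero    b x = refl
iter-+ f (suc a) b x = iter-+ f a b (f x)

sumFin-cong : ∀ {n} {f g : Fin n → ℕ} → (∀ i → f i ≡ g i) → sumFin f ≡ sumFin g
sumFin-cong {zero}  f≗g = refl
sumFin-cong {suc n} f≗g = cong₂ _+_ (f≗g zero) (sumFin-cong (f≗g ∘ suc))

module FaceTracing (G : Graph) (σ : Fin (n G) → Fin (n G) → Fin (n G)) where

  φ : Fin (n G) × Fin (n G) → Fin (n G) × Fin (n G)
  φ = faceStep G σ

  probe : Fin (n G) × Fin (n G) → ℕ → Bool
  probe d j = dartKey G d ≤ᵇ dartKey G (iter φ j d)

  minUpTo-probe : ∀ d k → minUpTo G σ d k ≡ true → ∀ j → j ≤ k → probe d j ≡ true
  minUpTo-probe d k       min zero    _ = Equivalence.to T-≡ (≤⇒≤ᵇ (≤-refl {dartKey G d}))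
  minUpTo-probe d (suc k) min (suc j) j≤k with m≤n⇒m<n∨m≡n j≤k
  ... | inj₁ j<k    = minUpTo-probe d k (∧-conicalʳ (probe d (suc k)) _ min) (suc j) (≤-pred j<k)
  ... | inj₂ refl   = ∧-conicalˡ (probe d (suc k)) _ min

  minUpTo-periodic : ∀ p d → iter φ (suc p) d ≡ d → ∀ i → minUpTo G σ d (i + p) ≡ minUpTo G σ d p
  minUpTo-periodic p d period zero    = refl
  minUpTo-periodic p d period (suc i) with minUpTo G σ d p in min | minUpTo-periodic p d period i
  ... | false | IH = trans (cong (probe d (suc (i + p)) ∧_) IH) (∧-zeroʳ _)
  ... | true  | IH = cong₂ _∧_ (trans wraps (minUpTo-probe d (i + p) IH i (m≤m+n i p))) IH
    where
    wraps : probe d (suc (i + p)) ≡ probe d i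
    wraps = cong (λ e → dartKey G d ≤ᵇ dartKey G e) (begin
      iter φ (suc (i + p)) d      ≡⟨ cong (λ k → iter φ (suc k) d) (+-comm i p) ⟩
      iter φ (suc p + i) d        ≡⟨ iter-+ φ (suc p) i d ⟩
      iter φ i (iter φ (suc p) d) ≡⟨ cong (iter φ i) period ⟩
      iter φ i d                  ∎)
      where open ≡-Reasoning

faces-periodic : (G : Graph) (σ : Fin (n G) → Fin (n G) → Fin (n G)) (p : ℕ) →
  (∀ u v → adj G u v ≡ true → iter (faceStep G σ) (suc p) (u , v) ≡ (u , v)) → p ≤ n G * n G →
  faces G σ ≡ sumFin (λ u → count (λ v → adj G u v ∧ minUpTo G σ (u , v) p))
faces-periodic G σ p period p≤n² = sumFin-cong λ u → count-cong λ v → on-darts u v (adj G u v) refl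
  where
  on-darts : ∀ u v b → adj G u v ≡ b → b ∧ minUpTo G σ (u , v) (n G * n G) ≡ b ∧ minUpTo G σ (u , v) p
  on-darts u v false _   = refl
  on-darts u v true  uv = subst (λ k → minUpTo G σ (u , v) k ≡ minUpTo G σ (u , v) p) (m∸n+n≡m p≤n²)
    (FaceTracing.minUpTo-periodic G σ p (u , v) (period u v uv) (n G * n G ∸ p))

-- Edge lists and line graphs

witness : ∀ {A : Set} (a? : Dec A) → does a? ≡ true → A
witness (yes a) _ = a

ShareEnd-sym : ∀ {m} (p q : Fin m × Fin m) → ShareEnd p q → ShareEnd q p
ShareEnd-sym _ _ (inj₁ (inj₁ a≡c)) = inj₁ (inj₁ (sym a≡c))
ShareEnd-sym _ _ (inj₁ (inj₂ a≡d)) = inj₂ (inj₁ (sym a≡d))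
ShareEnd-sym _ _ (inj₂ (inj₁ b≡c)) = inj₁ (inj₂ (sym b≡c))
ShareEnd-sym _ _ (inj₂ (inj₂ b≡d)) = inj₂ (inj₂ (sym b≡d))

shareEnd? : ∀ {m} (p q : Fin m × Fin m) → Dec (ShareEnd p q)
shareEnd? (a , b) (c , d) = (a ≟ c ⊎-dec a ≟ d) ⊎-dec (b ≟ c ⊎-dec b ≟ d)

module EdgeList {m k : ℕ} (e : Fin k → Fin m × Fin m)
  (e-ordered : ∀ x → toℕ (proj₁ (e x)) < toℕ (proj₂ (e x)))
  where

  listed? : ∀ a b → Dec (∃ λ x → e x ≡ (a , b))
  listed? a b = any? λ x → ≡-dec _≟_ _≟_ (e x) (a , b)

  edgeAdj : Fin m → Fin m → Bool
  edgeAdj a b = does (listed? a b) ∨ does (listed? b a)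

  unlisted-loop : ∀ a → does (listed? a a) ≡ false
  unlisted-loop a = dec-false (listed? a a) λ (x , ex) →
    <-irrefl (trans (cong (toℕ ∘ proj₁) ex) (sym (cong (toℕ ∘ proj₂) ex))) (e-ordered x)

  edgeGraph : Graph
  edgeGraph = record
    { n      = m
    ; adj    = edgeAdj
    ; sym    = λ a b → ∨-comm (does (listed? a b)) _
    ; irrefl = λ a → cong₂ _∨_ (unlisted-loop a) (unlisted-loop a)
    }

  lineAdj? : ∀ x y → Dec (x ≢ y × ShareEnd (e x) (e y))
  lineAdj? x y = ¬? (x ≟ y) ×-dec shareEnd? (e x) (e y)

  lineGraph : Graph
  lineGraph = record
    { n      = k
    ; adj    = λ x y → does (lineAdj? x y)
    ; sym    = λ x y → does-⇔ (mk⇔ (swap x y) (swap y x)) (lineAdj? x y) (lineAdj? y x)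
    ; irrefl = λ x → dec-false (lineAdj? x x) λ (x≢x , _) → x≢x refl
    }
    where
    swap : ∀ x y → x ≢ y × ShareEnd (e x) (e y) → y ≢ x × ShareEnd (e y) (e x)
    swap x y (x≢y , shared) = x≢y ∘ sym , ShareEnd-sym (e x) (e y) shared

  lineGraph-isLineGraphOf : (∀ x y → e x ≡ e y → x ≡ y) → IsLineGraphOf lineGraph edgeGraph
  lineGraph-isLineGraphOf e-injective = record
    { e       = e
    ; ordered = e-ordered
    ; isEdge  = λ x → cong (_∨ does (listed? (proj₂ (e x)) (proj₁ (e x)))) (dec-true (listed? _ _) (x , refl))
    ; inj     = e-injective
    ; surj    = surj
    ; adjIff  = λ x y → mk⇔ (witness (lineAdj? x y)) (dec-true (lineAdj? x y))
    }
    where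
    surj : ∀ a b → toℕ a < toℕ b → edgeAdj a b ≡ true → ∃ λ x → e x ≡ (a , b)
    surj a b a<b ab with listed? a b | listed? b a
    ... | yes listed | _ = listed
    ... | no _ | yes (x , ex) =
      ⊥-elim (<-asym a<b (subst₂ (λ p q → toℕ p < toℕ q) (cong proj₁ ex) (cong proj₂ ex) (e-ordered x)))

-- Local bounds in the line graph of a truncated cubic graph

∀-Bool? : {P : Bool → Set} → (∀ b → Dec (P b)) → Dec (∀ b → P b)
∀-Bool? P? = map′ (λ (Pf , Pt) → λ { false → Pf ; true → Pt }) (λ P → P false , P true) (P? false ×-dec P? true)

-- At a corner of a triangle of H, with port p and triangle edges i⁻ and i⁺, the flags record which of
-- the edges p i⁻, p i⁺ and i⁻ i⁺ of L(H) belong to the spanning tree.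
Flags : Set
Flags = Bool × Bool × Bool

∀-Flags? : {P : Flags → Set} → (∀ f → Dec (P f)) → Dec (∀ f → P f)
∀-Flags? P? = map′ (λ P f → P (proj₁ f) (proj₁ (proj₂ f)) (proj₂ (proj₂ f))) (λ P x y z → P (x , y , z))
  (∀-Bool? λ x → ∀-Bool? λ y → ∀-Bool? λ z → P? (x , y , z))

Triangle : Flags → Set
Triangle (x , y , z) = x ≡ true × y ≡ true × z ≡ true

edgesAt : Flags → ℕ
edgesAt (x , y , z) = ind x + ind y + ind z

oddPort : Flags → ℕ
oddPort (x , y , _) = ind (x xor y)

innerDegree : Flags → Flags → ℕ
innerDegree (_ , y , z) (x′ , _ , z′) = sum (map ind (y ∷ z ∷ x′ ∷ z′ ∷ []))

portDegree : Flags → Flags → ℕ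
portDegree (x , y , _) (x′ , y′ , _) = sum (map ind (x ∷ y ∷ x′ ∷ y′ ∷ []))

innerEdges : Flags → Flags → Flags → Flags
innerEdges (_ , _ , z₀) (_ , _ , z₁) (_ , _ , z₂) = z₀ , z₁ , z₂

-- f₀ f₁ f₂ are the flags at the corners 0, 1, 2 of a triangle of H, and innerDegree fₖ fₖ₊₁ is the
-- tree degree of the edge of this triangle joining corners k and k + 1.
gadget-bound : ∀ f₀ f₁ f₂ →
  innerDegree f₀ f₁ ≢ 2 → innerDegree f₁ f₂ ≢ 2 → innerDegree f₂ f₀ ≢ 2 →
  ¬ Triangle f₀ → ¬ Triangle f₁ → ¬ Triangle f₂ → ¬ Triangle (innerEdges f₀ f₁ f₂) →
  2 * (edgesAt f₀ + edgesAt f₁ + edgesAt f₂) ≤ 7 + (oddPort f₀ + oddPort f₁ + oddPort f₂)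
gadget-bound = from-yes (∀-Flags? λ f₀ → ∀-Flags? λ f₁ → ∀-Flags? λ f₂ →
  ¬? (innerDegree f₀ f₁ ℕ.≟ 2) →-dec ¬? (innerDegree f₁ f₂ ℕ.≟ 2) →-dec ¬? (innerDegree f₂ f₀ ℕ.≟ 2) →-dec
  ¬? (triangle? f₀) →-dec ¬? (triangle? f₁) →-dec ¬? (triangle? f₂) →-dec
  ¬? (triangle? (innerEdges f₀ f₁ f₂)) →-dec
  2 * (edgesAt f₀ + edgesAt f₁ + edgesAt f₂) ≤? 7 + (oddPort f₀ + oddPort f₁ + oddPort f₂))
  where
  triangle? : ∀ f → Dec (Triangle f)
  triangle? (x , y , z) = (x Bool.≟ true) ×-dec (y Bool.≟ true) ×-dec (z Bool.≟ true)

port-bound : ∀ f f′ → portDegree f f′ ≢ 2 → oddPort f + oddPort f′ ≤ 1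
port-bound = from-yes (∀-Flags? λ f → ∀-Flags? λ f′ →
  ¬? (portDegree f f′ ℕ.≟ 2) →-dec oddPort f + oddPort f′ ≤? 1)

-- The truncated triangular prism and its line graph

-- Vertex 3γ + k of H is corner k of the triangle replacing vertex γ of the prism; edge 3γ + k of H
-- joins corners k and k + 1 of that triangle, and edges 18–26 come from the nine edges of the prism.
edgeTable : Vec (Fin 18 × Fin 18) 27
edgeTable =
  (# 0 , # 1) ∷ (# 1 , # 2) ∷ (# 0 , # 2) ∷ (# 3 , # 4) ∷ (# 4 , # 5) ∷ (# 3 , # 5) ∷
  (# 6 , # 7) ∷ (# 7 , # 8) ∷ (# 6 , # 8) ∷ (# 9 , # 10) ∷ (# 10 , # 11) ∷ (# 9 , # 11) ∷
  (# 12 , # 13) ∷ (# 13 , # 14) ∷ (# 12 , # 14) ∷ (# 15 , # 16) ∷ (# 16 , # 17) ∷ (# 15 , # 17) ∷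
  (# 0 , # 5) ∷ (# 1 , # 11) ∷ (# 2 , # 6) ∷ (# 3 , # 8) ∷ (# 4 , # 12) ∷
  (# 7 , # 15) ∷ (# 9 , # 14) ∷ (# 10 , # 16) ∷ (# 13 , # 17) ∷ []

e : Fin 27 → Fin 18 × Fin 18
e = lookup edgeTable

e-ordered : ∀ x → toℕ (proj₁ (e x)) < toℕ (proj₂ (e x))
e-ordered = from-yes (all? λ x → toℕ (proj₁ (e x)) <? toℕ (proj₂ (e x)))

e-injective : ∀ x y → e x ≡ e y → x ≡ y
e-injective = from-yes (all? λ x → all? λ y → ≡-dec _≟_ _≟_ (e x) (e y) →-dec x ≟ y)

open EdgeList e e-ordered

H : Graph
H = edgeGraph

G : Graph
G = lineGraph

H-cubic : Cubic H
H-cubic = from-yes (all? λ a → count (adj H a) ℕ.≟ 3)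

G-regular : Regular 4 G
G-regular = from-yes (all? λ x → count (adj G x) ℕ.≟ 4)

G≅L[H] : IsLineGraphOf G H
G≅L[H] = lineGraph-isLineGraphOf e-injective

-- Induced by a plane drawing of H: around the edge ab of H come the other two edges at a, then the
-- other two edges at b, each pair in the rotation order of H.
rotationTable : Vec (Vec (Fin 27) 4) 27
rotationTable =
  (# 18 ∷ # 2 ∷ # 1 ∷ # 19 ∷ []) ∷ (# 19 ∷ # 0 ∷ # 2 ∷ # 20 ∷ []) ∷ (# 0 ∷ # 18 ∷ # 20 ∷ # 1 ∷ []) ∷
  (# 21 ∷ # 5 ∷ # 4 ∷ # 22 ∷ []) ∷ (# 22 ∷ # 3 ∷ # 5 ∷ # 18 ∷ []) ∷ (# 3 ∷ # 21 ∷ # 18 ∷ # 4 ∷ []) ∷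
  (# 20 ∷ # 8 ∷ # 7 ∷ # 23 ∷ []) ∷ (# 23 ∷ # 6 ∷ # 8 ∷ # 21 ∷ []) ∷ (# 6 ∷ # 20 ∷ # 21 ∷ # 7 ∷ []) ∷
  (# 24 ∷ # 11 ∷ # 10 ∷ # 25 ∷ []) ∷ (# 25 ∷ # 9 ∷ # 11 ∷ # 19 ∷ []) ∷ (# 9 ∷ # 24 ∷ # 19 ∷ # 10 ∷ []) ∷
  (# 22 ∷ # 14 ∷ # 13 ∷ # 26 ∷ []) ∷ (# 26 ∷ # 12 ∷ # 14 ∷ # 24 ∷ []) ∷ (# 12 ∷ # 22 ∷ # 24 ∷ # 13 ∷ []) ∷
  (# 23 ∷ # 17 ∷ # 16 ∷ # 25 ∷ []) ∷ (# 25 ∷ # 15 ∷ # 17 ∷ # 26 ∷ []) ∷ (# 15 ∷ # 23 ∷ # 26 ∷ # 16 ∷ []) ∷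
  (# 2 ∷ # 0 ∷ # 4 ∷ # 5 ∷ []) ∷ (# 0 ∷ # 1 ∷ # 10 ∷ # 11 ∷ []) ∷ (# 1 ∷ # 2 ∷ # 8 ∷ # 6 ∷ []) ∷
  (# 5 ∷ # 3 ∷ # 7 ∷ # 8 ∷ []) ∷ (# 3 ∷ # 4 ∷ # 14 ∷ # 12 ∷ []) ∷ (# 6 ∷ # 7 ∷ # 17 ∷ # 15 ∷ []) ∷
  (# 11 ∷ # 9 ∷ # 13 ∷ # 14 ∷ []) ∷ (# 9 ∷ # 10 ∷ # 15 ∷ # 16 ∷ []) ∷ (# 12 ∷ # 13 ∷ # 16 ∷ # 17 ∷ []) ∷ []

cyclicSuccessor : ∀ {m} → Vec (Fin m) 4 → Fin m → Fin m
cyclicSuccessor (a ∷ b ∷ c ∷ d ∷ []) u =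
  if does (u ≟ a) then b else if does (u ≟ b) then c else if does (u ≟ c) then d else a

σ : Fin 27 → Fin 27 → Fin 27
σ v = cyclicSuccessor (lookup rotationTable v)

rotation : Fin 27 → List (Fin 27)
rotation v = toList (lookup rotationTable v)

rotation-complete : ∀ v u → adj G v u ≡ true → u ∈ rotation v
rotation-complete = from-yes (all? λ v → all? λ u → adj G v u Bool.≟ true →-dec u ∈? rotation v)

rotation-adjacent : ∀ v → All (λ u → adj G v u ≡ true) (rotation v)
rotation-adjacent = from-yes (all? λ v → All.all? (λ u → adj G v u Bool.≟ true) (rotation v))

rotation-cyclic : ∀ v → All (λ u → All (λ w → ∃ λ (k : Fin 4) → iter (σ v) (toℕ k) u ≡ w) (rotation v))
                              (rotation v)
rotation-cyclic = from-yes (all? λ v → All.all? (λ u → All.all? (λ w →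
  any? {n = 4} λ k → iter (σ v) (toℕ k) u ≟ w) (rotation v)) (rotation v))

σ-rotation : IsRotation G σ
σ-rotation = record
  { closed = from-yes (all? λ v → all? λ u → adj G v u Bool.≟ true →-dec adj G v (σ v u) Bool.≟ true)
  ; cyclic = λ v u w vu vw → Product.map toℕ id
      (All.lookup (All.lookup (rotation-cyclic v) (rotation-complete v u vu)) (rotation-complete v w vw))
  }

faces-period : ∀ u v → adj G u v ≡ true → iter (faceStep G σ) 24 (u , v) ≡ (u , v)
faces-period = from-yes (all? λ u → all? λ v →
  adj G u v Bool.≟ true →-dec ≡-dec _≟_ _≟_ (iter (faceStep G σ) 24 (u , v)) (u , v))

-- The faces have lengths 3, 6 and 8; evaluating faces itself would trace n² = 729 steps per dart.
faces-G : faces G σ ≡ 29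
faces-G = faces-periodic G σ 23 faces-period (from-yes (23 ≤? 729))

-- With the implicit arguments left to unification, Agda would normalise faces G σ.
euler : n G + faces G σ ≡ edges G + 2
euler = subst (λ f → n G + f ≡ edges G + 2) {x = 29} {y = faces G σ} (sym faces-G) refl

G-planar : Planar G
G-planar = σ , σ-rotation , euler

-- Eight rounds of search, rather than 27, already reach every remaining vertex; this keeps the
-- 729 searches below cheap.
module Search = BreadthFirst (adj G) (Graph.sym G) rotation rotation-adjacent

search-avoiding : ∀ s t → ∃ λ r → avoiding s t r ≡ true ×
  (∀ w → avoiding s t w ≡ true → lookup (Search.reached (avoiding s t) r 8) w ≡ true)
search-avoiding = from-yes (all? λ s → all? λ t → any? λ r →
  (avoiding s t r Bool.≟ true) ×-dec Search.covers? (avoiding s t) r (Search.reached (avoiding s t) r 8))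

G-3-connected : KConnected 3 G
G-3-connected = three-connected G (from-yes (3 <? 27)) connected avoiding-connected
  where
  connected : ConnectedAdj (adj G)
  connected u v = Search.covers-sound (λ _ → true) zero refl 8
    (from-yes (Search.covers? (λ _ → true) zero (Search.reached (λ _ → true) zero 8))) u v refl refl
  avoiding-connected : ∀ s t u v → avoiding s t u ≡ true → avoiding s t v ≡ true →
                       Reach (adj G) (avoiding s t) u v
  avoiding-connected s t =
    let r , ok-r , covered = search-avoiding s t in Search.covers-sound (avoiding s t) r ok-r 8 covered

-- No HIST

Corner : Set
Corner = Fin 6 × Fin 3

before after : Corner → Corner
before (γ , 0F) = γ , 2F
before (γ , 1F) = γ , 0F
before (γ , 2F) = γ , 1F
after (γ , 0F) = γ , 1F
after (γ , 1F) = γ , 2F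
after (γ , 2F) = γ , 0F

before-after : ∀ c → before (after c) ≡ c
before-after (γ , 0F) = refl
before-after (γ , 1F) = refl
before-after (γ , 2F) = refl

inner : Corner → Fin 27
inner (γ , k) = combine γ k ↑ˡ 9

portTable : Vec (Vec (Fin 27) 3) 6
portTable =
  (# 18 ∷ # 19 ∷ # 20 ∷ []) ∷ (# 21 ∷ # 22 ∷ # 18 ∷ []) ∷ (# 20 ∷ # 23 ∷ # 21 ∷ []) ∷
  (# 24 ∷ # 25 ∷ # 19 ∷ []) ∷ (# 22 ∷ # 26 ∷ # 24 ∷ []) ∷ (# 23 ∷ # 25 ∷ # 26 ∷ []) ∷ []

port : Corner → Fin 27
port (γ , k) = lookup (lookup portTable γ) k

-- The port of corner c is the edge of H leaving the triangle of c; its other end is the corner partner c.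
partnerTable : Vec (Vec Corner 3) 6
partnerTable =
  ((# 1 , # 2) ∷ (# 3 , # 2) ∷ (# 2 , # 0) ∷ []) ∷ ((# 2 , # 2) ∷ (# 4 , # 0) ∷ (# 0 , # 0) ∷ []) ∷
  ((# 0 , # 2) ∷ (# 5 , # 0) ∷ (# 1 , # 0) ∷ []) ∷ ((# 4 , # 2) ∷ (# 5 , # 1) ∷ (# 0 , # 1) ∷ []) ∷
  ((# 1 , # 1) ∷ (# 5 , # 2) ∷ (# 3 , # 0) ∷ []) ∷ ((# 2 , # 1) ∷ (# 3 , # 1) ∷ (# 4 , # 1) ∷ []) ∷ []

partner : Corner → Corner
partner (γ , k) = lookup (lookup partnerTable γ) k

∀-Corner? : {P : Corner → Set} → (∀ c → Dec (P c)) → Dec (∀ c → P c)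
∀-Corner? P? = map′ (λ P c → P (proj₁ c) (proj₂ c)) (λ P γ k → P (γ , k)) (all? λ γ → all? λ k → P? (γ , k))

partner-involutive : ∀ c → partner (partner c) ≡ c
partner-involutive = from-yes (∀-Corner? λ c → ≡-dec _≟_ _≟_ (partner (partner c)) c)

port-partner : ∀ c → port (partner c) ≡ port c
port-partner = from-yes (∀-Corner? λ c → port (partner c) ≟ port c)

innerNeighbours portNeighbours : Corner → List (Fin 27)
innerNeighbours c = port c ∷ inner (before c) ∷ port (after c) ∷ inner (after c) ∷ []
portNeighbours c = inner (before c) ∷ inner c ∷ inner (before (partner c)) ∷ inner (partner c) ∷ []

innerNeighbours-complete : ∀ c → Unique (innerNeighbours c) ×
                                 (∀ w → adj G (inner c) w ≡ true → w ∈ innerNeighbours c)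
innerNeighbours-complete = from-yes (∀-Corner? λ c → unique? (innerNeighbours c) ×-dec
  all? λ w → adj G (inner c) w Bool.≟ true →-dec w ∈? innerNeighbours c)

portNeighbours-complete : ∀ c → Unique (portNeighbours c) ×
                                (∀ w → adj G (port c) w ≡ true → w ∈ portNeighbours c)
portNeighbours-complete = from-yes (∀-Corner? λ c → unique? (portNeighbours c) ×-dec
  all? λ w → adj G (port c) w Bool.≟ true →-dec w ∈? portNeighbours c)

cornerEdge : Corner → Fin 3 → Fin 27 × Fin 27
cornerEdge c 0F = port c , inner (before c)
cornerEdge c 1F = port c , inner c
cornerEdge c 2F = inner (before c) , inner c

-- The edges of G as the triangles of L(H) at the 18 vertices of H.
edgeFamily : Fin (18 * 3) → Fin 27 × Fin 27
edgeFamily j = uncurry (λ c′ r → cornerEdge (remQuot {6} 3 c′) r) (remQuot {18} 3 j)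

edgeFamily-covers : ∀ u v → adj G u v ≡ true → ∃ λ j → edgeFamily j ≡ (u , v) ⊎ edgeFamily j ≡ (v , u)
edgeFamily-covers = from-yes (all? λ u → all? λ v → adj G u v Bool.≟ true →-dec
  any? λ j → ≡-dec _≟_ _≟_ (edgeFamily j) (u , v) ⊎-dec ≡-dec _≟_ _≟_ (edgeFamily j) (v , u))

flags : (Fin 27 → Fin 27 → Bool) → Corner → Flags
flags T c = uncurry T (cornerEdge c 0F) , uncurry T (cornerEdge c 1F) , uncurry T (cornerEdge c 2F)

∑ᶜ : (Corner → ℕ) → ℕ
∑ᶜ f = ∑[ γ < 6 ] ∑[ k < 3 ] f (γ , k)

∑ᶜ-+ : ∀ f g → ∑ᶜ (λ c → f c + g c) ≡ ∑ᶜ f + ∑ᶜ g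
∑ᶜ-+ f g = trans (sum-cong-≗ λ γ → ∑-distrib-+ (λ k → f (γ , k)) (λ k → g (γ , k)))
  (∑-distrib-+ (λ γ → ∑[ k < 3 ] f (γ , k)) (λ γ → ∑[ k < 3 ] g (γ , k)))

∑ᶜ-mono : ∀ {f g} → (∀ c → f c ≤ g c) → ∑ᶜ f ≤ ∑ᶜ g
∑ᶜ-mono f≤g = ∑-mono-≤ λ γ → ∑-mono-≤ λ k → f≤g (γ , k)

∑ᶜ-partner : ∀ f → ∑ᶜ (f ∘ partner) ≡ ∑ᶜ f
∑ᶜ-partner f = begin
  ∑ᶜ (f ∘ partner)                    ≡⟨ ∑-remQuot (f ∘ partner) ⟨
  ∑[ j < 18 ] f (partner (corner j))  ≡⟨ sum-cong-≗ (λ j → cong f (corner-index (partner (corner j)))) ⟨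
  ∑[ j < 18 ] f (corner (π j))        ≡⟨ ∑-involution π π-involutive (f ∘ corner) ⟩
  ∑[ j < 18 ] f (corner j)            ≡⟨ ∑-remQuot f ⟩
  ∑ᶜ f                                ∎
  where
  open ≡-Reasoning
  corner : Fin 18 → Corner
  corner = remQuot {6} 3
  index : Corner → Fin 18
  index = uncurry combine
  π : Fin 18 → Fin 18
  π j = index (partner (corner j))
  corner-index : ∀ c → corner (index c) ≡ c
  corner-index = uncurry remQuot-combine
  π-involutive : ∀ j → π (π j) ≡ j
  π-involutive j = begin
    index (partner (corner (π j)))        ≡⟨ cong (index ∘ partner) (corner-index (partner (corner j))) ⟩
    index (partner (partner (corner j)))  ≡⟨ cong index (partner-involutive (corner j)) ⟩
    index (corner j)                      ≡⟨ combine-remQuot {6} 3 j ⟩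
    j                                     ∎

module _ (T : Fin 27 → Fin 27 → Bool) (hist : IsHIST G T) where
  open SpanningTree (proj₁ hist)

  T-irrefl : ∀ v → T v v ≡ false
  T-irrefl v with T v v in Tvv
  ... | false = refl
  ... | true with () ← trans (sym (Graph.irrefl G v)) (subgraph v v Tvv)

  no-triangle : ∀ {x y z} → T x y ≡ true → T y z ≡ true → T z x ≡ true → ⊥
  no-triangle = acyclic⇒no-triangle acyclic T-irrefl

  degree-inner : ∀ c → count (T (inner c)) ≡ innerDegree (flags T c) (flags T (after c))
  degree-inner c = begin
    count (T i)
      ≡⟨ count-enumerated (T i) (innerNeighbours c) (proj₁ (innerNeighbours-complete c))
                    (λ w Tiw → proj₂ (innerNeighbours-complete c) w (subgraph i w Tiw)) ⟩
    sum (map ind (T i (port c) ∷ T i (inner (before c)) ∷ T i (port (after c)) ∷ T i (inner (after c)) ∷ []))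
      ≡⟨ cong (λ bs → sum (map ind bs))
           (cong₂ _∷_ (symT i _) (cong₂ _∷_ (symT i _) (cong₂ _∷_ (symT i _)
             (refl {x = T i (inner (after c)) ∷ []})))) ⟩
    sum (map ind (T (port c) i ∷ T (inner (before c)) i ∷ T (port (after c)) i ∷ T i (inner (after c)) ∷ []))
      ≡⟨ cong (λ c′ → sum (map ind (T (port c) i ∷ T (inner (before c)) i ∷
                                      T (port (after c)) (inner c′) ∷ T (inner c′) (inner (after c)) ∷ [])))
              (before-after c) ⟨
    innerDegree (flags T c) (flags T (after c))
      ∎
    where
    open ≡-Reasoning
    i : Fin 27
    i = inner c

  degree-port : ∀ c → count (T (port c)) ≡ portDegree (flags T c) (flags T (partner c))
  degree-port c =
    trans (count-enumerated (T (port c)) (portNeighbours c) (proj₁ (portNeighbours-complete c))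
                      (λ w Tpw → proj₂ (portNeighbours-complete c) w (subgraph (port c) w Tpw)))
          (cong (λ p → sum (map ind (T (port c) (inner (before c)) ∷ T (port c) (inner c) ∷
                                     T p (inner (before (partner c))) ∷ T p (inner (partner c)) ∷ [])))
                (sym (port-partner c)))

  corner-acyclic : ∀ c → ¬ Triangle (flags T c)
  corner-acyclic c (Tpb , Tpi , Tbi) = no-triangle Tpb Tbi (trans (symT (inner c) (port c)) Tpi)

  gadget : ∀ γ → 2 * ∑[ k < 3 ] edgesAt (flags T (γ , k)) ≤ 7 + ∑[ k < 3 ] oddPort (flags T (γ , k))
  gadget γ = subst₂ (λ e o → 2 * e ≤ 7 + o) (sym (∑-Fin3 (edgesAt ∘ f))) (sym (∑-Fin3 (oddPort ∘ f)))
    (gadget-bound (f 0F) (f 1F) (f 2F) (inner-degree 0F) (inner-degree 1F) (inner-degree 2F)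
      (corner-acyclic (γ , 0F)) (corner-acyclic (γ , 1F)) (corner-acyclic (γ , 2F))
      λ (T20 , T01 , T12) → no-triangle T01 T12 T20)
    where
    f : Fin 3 → Flags
    f k = flags T (γ , k)
    inner-degree : ∀ k → innerDegree (f k) (flags T (after (γ , k))) ≢ 2
    inner-degree k deg≡2 = proj₂ hist (inner (γ , k)) (trans (degree-inner (γ , k)) deg≡2)

  port-side : ∀ c → oddPort (flags T c) + oddPort (flags T (partner c)) ≤ 1
  port-side c = port-bound (flags T c) (flags T (partner c))
    λ deg≡2 → proj₂ hist (port c) (trans (degree-port c) deg≡2)

  tree-edges : 26 ≤ ∑ᶜ (edgesAt ∘ flags T)
  tree-edges = ≤-pred (subst (λ s → 27 ≤ suc s) edge-count
    (connected⇒spanning-edges T symT edgeFamily (λ u v Tuv → edgeFamily-covers u v (subgraph u v Tuv))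
                              connected))
    where
    edge-count : ∑[ j < 18 * 3 ] ind (uncurry T (edgeFamily j)) ≡ ∑ᶜ (edgesAt ∘ flags T)
    edge-count = begin
      ∑[ j < 18 * 3 ] ind (uncurry T (edgeFamily j))
        ≡⟨ ∑-remQuot (λ (c′ , r) → ind (uncurry T (cornerEdge (remQuot {6} 3 c′) r))) ⟩
      ∑[ c′ < 18 ] ∑[ r < 3 ] ind (uncurry T (cornerEdge (remQuot {6} 3 c′) r))
        ≡⟨ ∑-remQuot (λ c → ∑[ r < 3 ] ind (uncurry T (cornerEdge c r))) ⟩
      ∑[ γ < 6 ] ∑[ k < 3 ] ∑[ r < 3 ] ind (uncurry T (cornerEdge (γ , k) r))
        ≡⟨ sum-cong-≗ (λ γ → sum-cong-≗ λ k → ∑-Fin3 λ r → ind (uncurry T (cornerEdge (γ , k) r))) ⟩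
      ∑ᶜ (edgesAt ∘ flags T)
        ∎
      where open ≡-Reasoning

  gadgets : 2 * ∑ᶜ (edgesAt ∘ flags T) ≤ 42 + ∑ᶜ (oddPort ∘ flags T)
  gadgets = begin
    2 * ∑ᶜ (edgesAt ∘ flags T)                ≡⟨ *-distribˡ-sum 2 (λ γ → ∑[ k < 3 ] s (γ , k)) ⟩
    ∑[ γ < 6 ] (2 * ∑[ k < 3 ] s (γ , k))     ≤⟨ ∑-mono-≤ gadget ⟩
    ∑[ γ < 6 ] (7 + ∑[ k < 3 ] o (γ , k))     ≡⟨ ∑-distrib-+ (λ _ → 7) (λ γ → ∑[ k < 3 ] o (γ , k)) ⟩
    42 + ∑ᶜ (oddPort ∘ flags T)               ∎
    where
    open ≤-Reasoning
    s o : Corner → ℕ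
    s = edgesAt ∘ flags T
    o = oddPort ∘ flags T

  ports : ∑ᶜ (oddPort ∘ flags T) + ∑ᶜ (oddPort ∘ flags T) ≤ 18
  ports = begin
    ∑ᶜ o + ∑ᶜ o                        ≡⟨ cong (∑ᶜ o +_) (∑ᶜ-partner o) ⟨
    ∑ᶜ o + ∑ᶜ (o ∘ partner)            ≡⟨ ∑ᶜ-+ o (o ∘ partner) ⟨
    ∑ᶜ (λ c → o c + o (partner c))     ≤⟨ ∑ᶜ-mono port-side ⟩
    ∑ᶜ (λ _ → 1)                       ∎
    where
    open ≤-Reasoning
    o : Corner → ℕ
    o = oddPort ∘ flags T

counting-contradiction : ∀ {S O} → 26 ≤ S → 2 * S ≤ 42 + O → O + O ≤ 18 → ⊥
counting-contradiction {S} {O} 26≤S 2S≤42+O O+O≤18 = ≤⇒≯ (≤-trans (+-mono-≤ 10≤O 10≤O) O+O≤18) (n≤1+n 19)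
  where
  10≤O : 10 ≤ O
  10≤O = +-cancelˡ-≤ 42 10 O (≤-trans (*-monoʳ-≤ 2 26≤S) 2S≤42+O)

G-has-no-HIST : ¬ HasHIST G
G-has-no-HIST (T , hist) = counting-contradiction (tree-edges T hist) (gadgets T hist) (ports T hist)

proposition6 : Σ Graph λ G →
    KConnected 3 G × Regular 4 G × Planar G × ¬ HasHIST G ×
    Σ Graph (λ H → Cubic H × IsLineGraphOf G H)
proposition6 = G , G-3-connected , G-regular , G-planar , G-has-no-HIST , H , H-cubic , G≅L[H]
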